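{- The sign pattern $\begin{bmatrix}0&-&+\\+&0&-\\-&+&0\end{bmatrix}$ requires algebraic positivity.
   Context: For a sign pattern $S$ (matrix with entries in $\{+,-,0\}$), $Q(S)$ is the set of real matrices $X$ with $\mathrm{sgn}(X_{ij})=S_{ij}$ for all $i,j$. A real square matrix $M$ is algebraically positive if there is a real polynomial $p$ with all entries of $p(M)$ positive. $S$ requires algebraic positivity if every $X\in Q(S)$ is algebraically positive. -}

module Defs where

open import Level using (0ℓ)
open import Data.Nat using (ℕ; zero; suc)
open import Data.Fin using (Fin; zero; suc)
open import Data.List using (List; []; _∷_)
open import Data.Sum using (_⊎_)
open import Data.Product using (Σ; ∃; _×_; _,_)
open import Relation.Nullary using (¬_)
open import Relation.Binary.PropositionalEquality using (_≡_)
open import Relation.Binary.Structures using (IsStrictTotalOrder)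
open import Algebra.Structures using (IsCommutativeRing)

-- The real numbers, given axiomatically as a (Dedekind-)complete ordered
-- field. Any two such structures are isomorphic to ℝ, so quantifying over
-- all of them is the same as speaking about ℝ.
record RealNumbers : Set₁ where
  infixl 6 _+_
  infixl 7 _*_
  infix  4 _<_
  field
    ℝ   : Set
    _+_ : ℝ → ℝ → ℝ
    _*_ : ℝ → ℝ → ℝ
    -_  : ℝ → ℝ
    0ℝ  : ℝ
    1ℝ  : ℝ
    _<_ : ℝ → ℝ → Set
    isCommutativeRing : IsCommutativeRing _≡_ _+_ _*_ -_ 0ℝ 1ℝ
    isStrictTotalOrder : IsStrictTotalOrder _≡_ _<_
    0≢1      : ¬ (0ℝ ≡ 1ℝ)
    inverse  : ∀ x → ¬ (x ≡ 0ℝ) → Σ ℝ λ y → x * y ≡ 1ℝ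
    +-mono-< : ∀ {x y} z → x < y → x + z < y + z
    *-pos    : ∀ {x y} → 0ℝ < x → 0ℝ < y → 0ℝ < x * y
    completeness : (P : ℝ → Set) → (∃ λ x → P x) →
                   (∃ λ b → ∀ x → P x → (x < b ⊎ x ≡ b)) →
                   ∃ λ s → (∀ x → P x → (x < s ⊎ x ≡ s)) ×
                           (∀ b → (∀ x → P x → (x < b ⊎ x ≡ b)) → (s < b ⊎ s ≡ b))

data Sign : Set where
  ⊕ ⊖ ⊙ : Sign

module _ (R : RealNumbers) where
  open RealNumbers R

  Matrix : ℕ → Set
  Matrix n = Fin n → Fin n → ℝ

  HasSign : ℝ → Sign → Set
  HasSign x ⊕ = 0ℝ < x
  HasSign x ⊖ = x < 0ℝ
  HasSign x ⊙ = x ≡ 0ℝ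

  InQ : ∀ {n} → (Fin n → Fin n → Sign) → Matrix n → Set
  InQ S X = ∀ i j → HasSign (X i j) (S i j)

  sumFin : ∀ n → (Fin n → ℝ) → ℝ
  sumFin zero    f = 0ℝ
  sumFin (suc n) f = f zero + sumFin n (λ i → f (suc i))

  _⊞_ : ∀ {n} → Matrix n → Matrix n → Matrix n
  (A ⊞ B) i j = A i j + B i j

  _⊠_ : ∀ {n} → Matrix n → Matrix n → Matrix n
  _⊠_ {n} A B i j = sumFin n (λ k → A i k * B k j)

  identity : ∀ {n} → Matrix n
  identity {suc n} zero    zero    = 1ℝ
  identity {suc n} zero    (suc j) = 0ℝ
  identity {suc n} (suc i) zero    = 0ℝ
  identity {suc n} (suc i) (suc j) = identity {n} i j

  -- A real polynomial given by its coefficient list c₀ ∷ c₁ ∷ … ∷ [],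
  -- evaluated at a square matrix (Horner): p(M) = c₀ I + M (c₁ I + M (…)).
  evalPoly : ∀ {n} → List ℝ → Matrix n → Matrix n
  evalPoly []       M i j = 0ℝ
  evalPoly (c ∷ cs) M i j = ((λ a b → c * identity a b) ⊞ (M ⊠ evalPoly cs M)) i j

  AlgebraicallyPositive : ∀ {n} → Matrix n → Set
  AlgebraicallyPositive M = Σ (List ℝ) λ p → ∀ i j → 0ℝ < evalPoly p M i j

  RequiresAlgebraicPositivity : ∀ {n} → (Fin n → Fin n → Sign) → Set
  RequiresAlgebraicPositivity S = ∀ X → InQ S X → AlgebraicallyPositive X

S₃ : Fin 3 → Fin 3 → Sign
S₃ zero zero = ⊙
S₃ zero (suc zero) = ⊖
S₃ zero (suc (suc zero)) = ⊕
S₃ (suc zero) zero = ⊕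
S₃ (suc zero) (suc zero) = ⊙
S₃ (suc zero) (suc (suc zero)) = ⊖
S₃ (suc (suc zero)) zero = ⊖
S₃ (suc (suc zero)) (suc zero) = ⊕
S₃ (suc (suc zero)) (suc (suc zero)) = ⊙

module Submission where

-- A real matrix with sign pattern S₃ has the form
--     X = [[0, -x₀, y₀], [y₁, 0, -x₁], [-x₂, y₂, 0]]   with all xᵢ, yᵢ > 0.
-- Put t₀ = x₀y₁, t₁ = x₁y₂, t₂ = x₂y₀, s = t₀ + t₁ + t₂ and take
--     p(z) = γ + βz + αz²,   α = s + 1,  β = y₀y₁y₂,  γ = αs + 1.
-- Each entry of p(X) = γI + βX + αX² is a polynomial identity away from a
-- subtraction-free expression, e.g. p(X)₀₀ = 1 + αt₁,
-- p(X)₀₁ = y₀y₂(1 + t₁ + t₂), p(X)₀₂ = βy₀ + αx₀x₁; such expressions are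
-- positive at positive arguments.

open import Defs hiding (Sign; ⊕; ⊖; ⊙)

open import Algebra.Bundles using (CommutativeRing)
open import Algebra.Solver.Ring.AlmostCommutativeRing
  using (fromCommutativeRing; _-Raw-AlmostCommutative⟶_)
open import Data.Empty using (⊥-elim)
open import Data.Fin.Base using (Fin; zero; suc)
open import Data.Fin.Patterns using (0F; 1F; 2F; 3F; 4F; 5F)
open import Data.Integer.Base as Int using (ℤ; 0ℤ; 1ℤ)
import Data.Integer.Properties as Intₚ
open import Data.List.Base using (List; []; _∷_)
open import Data.Maybe.Base using (Maybe; just; nothing)
open import Data.Nat.Base as ℕ using (ℕ; zero; suc)
import Data.Nat.Properties as ℕ
open import Data.Product.Base using (_,_)
open import Data.Sign.Base as Sign using (Sign)
open import Data.Vec.Base using (Vec; []; _∷_; lookup)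
open import Relation.Binary.Definitions using (tri<; tri≈; tri>)
import Relation.Binary.PropositionalEquality as ≡
open import Relation.Binary.Structures using (IsStrictTotalOrder)
open import Relation.Nullary.Decidable.Core using (yes; no)

-- The solver of the library needs a homomorphism from a coefficient ring
-- whose equality is decidable; we use the canonical map ℤ → R.
module IntegerCoefficients {c ℓ} (CR : CommutativeRing c ℓ) where
  open CommutativeRing CR
  open Int using (+_; -[1+_]; sign; ∣_∣; _◃_; _⊖_)
  open import Algebra.Properties.Ring ring
    using (-‿involutive; -‿distribˡ-*; -‿distribʳ-*; -0#≈0#; -‿+-comm)
  open import Algebra.Properties.CommutativeSemigroup +-commutativeSemigroup
    using (x∙yz≈y∙xz)
  open import Algebra.Properties.Semiring.Mult.TCOptimised semiring
    using (_×_; ×-homo-+; ×1-homo-*; 1+×)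
  open import Relation.Binary.Reasoning.Setoid setoid

  infixr 8 _⋆_
  _⋆_ : Sign → Carrier → Carrier
  Sign.+ ⋆ x = x
  Sign.- ⋆ x = - x

  ⋆-cong : ∀ s {x y} → x ≈ y → s ⋆ x ≈ s ⋆ y
  ⋆-cong Sign.+ x≈y = x≈y
  ⋆-cong Sign.- x≈y = -‿cong x≈y

  ⋆-* : ∀ s t x y → (s Sign.* t) ⋆ (x * y) ≈ (s ⋆ x) * (t ⋆ y)
  ⋆-* Sign.+ Sign.+ x y = refl
  ⋆-* Sign.+ Sign.- x y = -‿distribʳ-* x y
  ⋆-* Sign.- Sign.+ x y = -‿distribˡ-* x y
  ⋆-* Sign.- Sign.- x y = begin
    x * y        ≈⟨ -‿involutive (x * y) ⟨
    - - (x * y)  ≈⟨ -‿cong (-‿distribʳ-* x y) ⟩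
    - (x * - y)  ≈⟨ -‿distribˡ-* x (- y) ⟩
    - x * - y    ∎

  -- The canonical map ℤ → R.  It sends + 0 and + 1 to 0# and 1#
  -- definitionally, so formal constants 0 and 1 evaluate to 0# and 1#.
  ⟦_⟧ℤ : ℤ → Carrier
  ⟦ i ⟧ℤ = sign i ⋆ (∣ i ∣ × 1#)

  ◃-homo : ∀ s n → ⟦ s ◃ n ⟧ℤ ≈ s ⋆ (n × 1#)
  ◃-homo Sign.+ zero    = refl
  ◃-homo Sign.- zero    = sym -0#≈0#
  ◃-homo Sign.+ (suc n) = refl
  ◃-homo Sign.- (suc n) = refl

  ⊖-homo : ∀ m n → ⟦ m ⊖ n ⟧ℤ ≈ m × 1# + - (n × 1#)
  ⊖-homo m       zero    = begin
    m × 1#          ≈⟨ +-identityʳ _ ⟨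
    m × 1# + 0#     ≈⟨ +-congˡ -0#≈0# ⟨
    m × 1# + - 0#   ∎
  ⊖-homo zero    (suc n) = sym (+-identityˡ _)
  ⊖-homo (suc m) (suc n) = begin
    ⟦ suc m ⊖ suc n ⟧ℤ               ≡⟨ ≡.cong ⟦_⟧ℤ (Intₚ.[1+m]⊖[1+n]≡m⊖n m n) ⟩
    ⟦ m ⊖ n ⟧ℤ                       ≈⟨ ⊖-homo m n ⟩
    m × 1# + - (n × 1#)              ≈⟨ shift (m × 1#) (n × 1#) ⟩
    (1# + m × 1#) + - (1# + n × 1#)  ≈⟨ +-cong (1+× m 1#) (-‿cong (1+× n 1#)) ⟨
    suc m × 1# + - (suc n × 1#)      ∎
    where
    shift : ∀ a b → a + - b ≈ (1# + a) + - (1# + b)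
    shift a b = begin
      a + - b                  ≈⟨ +-identityˡ _ ⟨
      0# + (a + - b)           ≈⟨ +-congʳ (-‿inverseʳ 1#) ⟨
      (1# + - 1#) + (a + - b)  ≈⟨ +-assoc _ _ _ ⟩
      1# + (- 1# + (a + - b))  ≈⟨ +-congˡ (x∙yz≈y∙xz (- 1#) a (- b)) ⟩
      1# + (a + (- 1# + - b))  ≈⟨ +-assoc _ _ _ ⟨
      (1# + a) + (- 1# + - b)  ≈⟨ +-congˡ (-‿+-comm 1# b) ⟩
      (1# + a) + - (1# + b)    ∎

  +-homo : ∀ i j → ⟦ i Int.+ j ⟧ℤ ≈ ⟦ i ⟧ℤ + ⟦ j ⟧ℤ
  +-homo (+ m)    (+ n)    = ×-homo-+ 1# m n
  +-homo (+ m)    -[1+ n ] = ⊖-homo m (suc n)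
  +-homo -[1+ m ] (+ n)    = trans (⊖-homo n (suc m)) (+-comm _ _)
  +-homo -[1+ m ] -[1+ n ] = begin
    - (suc (suc (m ℕ.+ n)) × 1#)     ≡⟨ ≡.cong (λ k → - (k × 1#)) (ℕ.+-suc (suc m) n) ⟨
    - ((suc m ℕ.+ suc n) × 1#)       ≈⟨ -‿cong (×-homo-+ 1# (suc m) (suc n)) ⟩
    - (suc m × 1# + suc n × 1#)      ≈⟨ -‿+-comm _ _ ⟨
    - (suc m × 1#) + - (suc n × 1#)  ∎

  *-homo : ∀ i j → ⟦ i Int.* j ⟧ℤ ≈ ⟦ i ⟧ℤ * ⟦ j ⟧ℤ
  *-homo i j = begin
    ⟦ sign i Sign.* sign j ◃ ∣ i ∣ ℕ.* ∣ j ∣ ⟧ℤ               ≈⟨ ◃-homo (sign i Sign.* sign j) (∣ i ∣ ℕ.* ∣ j ∣) ⟩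
    (sign i Sign.* sign j) ⋆ ((∣ i ∣ ℕ.* ∣ j ∣) × 1#)        ≈⟨ ⋆-cong (sign i Sign.* sign j) (×1-homo-* ∣ i ∣ ∣ j ∣) ⟩
    (sign i Sign.* sign j) ⋆ ((∣ i ∣ × 1#) * (∣ j ∣ × 1#))  ≈⟨ ⋆-* (sign i) (sign j) _ _ ⟩
    ⟦ i ⟧ℤ * ⟦ j ⟧ℤ                                          ∎

  -‿homo : ∀ i → ⟦ Int.- i ⟧ℤ ≈ - ⟦ i ⟧ℤ
  -‿homo (+ zero)  = sym -0#≈0#
  -‿homo (+ suc n) = refl
  -‿homo -[1+ n ]  = sym (-‿involutive _)

  ℤ-homomorphism : Int.+-*-rawRing -Raw-AlmostCommutative⟶ fromCommutativeRing CR
  ℤ-homomorphism = record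
    { ⟦_⟧    = ⟦_⟧ℤ
    ; +-homo = +-homo
    ; *-homo = *-homo
    ; -‿homo = -‿homo
    ; 0-homo = refl
    ; 1-homo = refl
    }

  _≟ℤ_ : ∀ i j → Maybe (⟦ i ⟧ℤ ≈ ⟦ j ⟧ℤ)
  i ≟ℤ j with i Intₚ.≟ j
  ... | yes ≡.refl = just refl
  ... | no _     = nothing

  open import Algebra.Solver.Ring Int.+-*-rawRing (fromCommutativeRing CR) ℤ-homomorphism _≟ℤ_
    public

data PositiveExpr (n : ℕ) : Set where
  atom    : Fin n → PositiveExpr n
  one     : PositiveExpr n
  _⊕_ _⊗_ : PositiveExpr n → PositiveExpr n → PositiveExpr n

infixl 6 _⊕_
infixl 7 _⊗_

-- The argument over a fixed complete ordered field R; only its ordered-ring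
-- structure is used.
module Theory (R : RealNumbers) where
  open RealNumbers R
  open IsStrictTotalOrder isStrictTotalOrder using (compare) renaming (trans to <-trans)

  commutativeRing : CommutativeRing _ _
  commutativeRing = record { isCommutativeRing = isCommutativeRing }

  open CommutativeRing commutativeRing
    using ( +-identityˡ; +-identityʳ; *-identityʳ; zeroʳ; distribˡ; -‿inverseʳ
          ; +-commutativeSemigroup; *-commutativeSemigroup; ring)
  open import Algebra.Properties.Ring ring using (-‿involutive; -1*x≈-x)
  open import Algebra.Properties.CommutativeSemigroup +-commutativeSemigroup using (interchange)
  open import Algebra.Properties.CommutativeSemigroup *-commutativeSemigroup using (x∙yz≈y∙xz)
  open IntegerCoefficients commutativeRing
    using (Polynomial; con; var; _:+_; _:*_; :-_; ⟦_⟧; ⟦_⟧↓; prove)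
  open ≡ using (_≡_; refl; sym; trans; cong; cong₂; subst; subst₂)
  open ≡.≡-Reasoning

  +-pos : ∀ {x y} → 0ℝ < x → 0ℝ < y → 0ℝ < x + y
  +-pos {x} {y} 0<x 0<y = <-trans 0<y (subst (_< x + y) (+-identityˡ y) (+-mono-< y 0<x))

  neg-pos : ∀ {x} → x < 0ℝ → 0ℝ < - x
  neg-pos {x} x<0 = subst₂ _<_ (-‿inverseʳ x) (+-identityˡ (- x)) (+-mono-< (- x) x<0)

  -- 1 is positive: otherwise 1 = (-1)(-1) would be a product of positives.
  0<1 : 0ℝ < 1ℝ
  0<1 with compare 0ℝ 1ℝ
  ... | tri< 0<1 _ _ = 0<1
  ... | tri≈ _ 0≡1 _ = ⊥-elim (0≢1 0≡1)
  ... | tri> _ _ 1<0 = subst (0ℝ <_) -1*-1≡1 (*-pos (neg-pos 1<0) (neg-pos 1<0))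
    where
    -1*-1≡1 : - 1ℝ * - 1ℝ ≡ 1ℝ
    -1*-1≡1 = trans (-1*x≈-x (- 1ℝ)) (-‿involutive 1ℝ)

  sumFin-cong : ∀ n {f g : Fin n → ℝ} → (∀ k → f k ≡ g k) → sumFin R n f ≡ sumFin R n g
  sumFin-cong zero    f≗g = refl
  sumFin-cong (suc n) f≗g = cong₂ _+_ (f≗g zero) (sumFin-cong n (λ k → f≗g (suc k)))

  sumFin-0 : ∀ n {f : Fin n → ℝ} → (∀ k → f k ≡ 0ℝ) → sumFin R n f ≡ 0ℝ
  sumFin-0 zero    f≗0 = refl
  sumFin-0 (suc n) f≗0 =
    trans (cong₂ _+_ (f≗0 zero) (sumFin-0 n (λ k → f≗0 (suc k)))) (+-identityʳ 0ℝ)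

  sumFin-+ : ∀ n (f g : Fin n → ℝ) → sumFin R n (λ k → f k + g k) ≡ sumFin R n f + sumFin R n g
  sumFin-+ zero    f g = sym (+-identityʳ 0ℝ)
  sumFin-+ (suc n) f g = trans (cong ((f zero + g zero) +_) (sumFin-+ n (λ k → f (suc k)) (λ k → g (suc k))))
                               (interchange _ _ _ _)

  sumFin-*ˡ : ∀ n c (f : Fin n → ℝ) → sumFin R n (λ k → c * f k) ≡ c * sumFin R n f
  sumFin-*ˡ zero    c f = sym (zeroʳ c)
  sumFin-*ˡ (suc n) c f = trans (cong ((c * f zero) +_) (sumFin-*ˡ n c (λ k → f (suc k))))
                                (sym (distribˡ c _ _))

  sumFin-identity : ∀ n (f : Fin n → ℝ) j → sumFin R n (λ k → f k * identity R k j) ≡ f j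
  sumFin-identity (suc n) f zero    = begin
    f zero * 1ℝ + sumFin R n (λ k → f (suc k) * 0ℝ)  ≡⟨ cong (f zero * 1ℝ +_) (sumFin-0 n (λ k → zeroʳ (f (suc k)))) ⟩
    f zero * 1ℝ + 0ℝ                                 ≡⟨ +-identityʳ _ ⟩
    f zero * 1ℝ                                      ≡⟨ *-identityʳ _ ⟩
    f zero                                           ∎
  sumFin-identity (suc n) f (suc j) = begin
    f zero * 0ℝ + sumFin R n (λ k → f (suc k) * identity R k j)  ≡⟨ cong₂ _+_ (zeroʳ (f zero)) (sumFin-identity n (λ k → f (suc k)) j) ⟩
    0ℝ + f (suc j)                                               ≡⟨ +-identityˡ _ ⟩
    f (suc j)                                                    ∎

  infixl 7 _·_ _∙_
  _·_ : ∀ {n} → Matrix R n → Matrix R n → Matrix R n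
  _·_ = _⊠_ R

  scalar : ∀ {n} → ℝ → Matrix R n
  scalar c i j = c * identity R i j

  _∙_ : ∀ {n} → ℝ → Matrix R n → Matrix R n
  (c ∙ A) i j = c * A i j

  ·-congʳ : ∀ {n} (M : Matrix R n) {A B : Matrix R n} → (∀ i j → A i j ≡ B i j) →
            ∀ i j → (M · A) i j ≡ (M · B) i j
  ·-congʳ {n} M A≗B i j = sumFin-cong n (λ k → cong (M i k *_) (A≗B k j))

  ·-zero : ∀ {n} (M : Matrix R n) i j → (M · (λ _ _ → 0ℝ)) i j ≡ 0ℝ
  ·-zero {n} M i j = sumFin-0 n (λ k → zeroʳ (M i k))

  ·-⊞ : ∀ {n} (M A B : Matrix R n) i j → (M · _⊞_ R A B) i j ≡ (M · A) i j + (M · B) i j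
  ·-⊞ {n} M A B i j =
    trans (sumFin-cong n (λ k → distribˡ (M i k) (A k j) (B k j))) (sumFin-+ n _ _)

  ·-∙ : ∀ {n} (M : Matrix R n) c A i j → (M · (c ∙ A)) i j ≡ c * (M · A) i j
  ·-∙ {n} M c A i j =
    trans (sumFin-cong n (λ k → x∙yz≈y∙xz (M i k) c (A k j))) (sumFin-*ˡ n c _)

  ·-scalar : ∀ {n} (M : Matrix R n) c i j → (M · scalar c) i j ≡ c * M i j
  ·-scalar {n} M c i j = trans (·-∙ M c (identity R) i j) (cong (c *_) (sumFin-identity n (M i) j))

  evalPoly-cong : ∀ {n} (p : List ℝ) {M N : Matrix R n} → (∀ i j → M i j ≡ N i j) →
                  ∀ i j → evalPoly R p M i j ≡ evalPoly R p N i j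
  evalPoly-cong []       M≗N i j = refl
  evalPoly-cong (c ∷ cs) M≗N i j = cong (c * identity R i j +_)
    (sumFin-cong _ (λ k → cong₂ _*_ (M≗N i k) (evalPoly-cong cs M≗N k j)))

  evalPoly-quadratic : ∀ {n} γ β α (M : Matrix R n) i j →
    evalPoly R (γ ∷ β ∷ α ∷ []) M i j ≡ γ * identity R i j + (β * M i j + α * (M · M) i j)
  evalPoly-quadratic γ β α M i j = cong (γ * identity R i j +_) (begin
    (M · evalPoly R (β ∷ α ∷ []) M) i j     ≡⟨ ·-congʳ M linear i j ⟩
    (M · _⊞_ R (scalar β) (α ∙ M)) i j      ≡⟨ ·-⊞ M (scalar β) (α ∙ M) i j ⟩
    (M · scalar β) i j + (M · (α ∙ M)) i j  ≡⟨ cong₂ _+_ (·-scalar M β i j) (·-∙ M α M i j) ⟩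
    β * M i j + α * (M · M) i j             ∎)
    where
    constant : ∀ k j → evalPoly R (α ∷ []) M k j ≡ scalar α k j
    constant k j = trans (cong (scalar α k j +_) (·-zero M k j)) (+-identityʳ _)

    linear : ∀ k j → evalPoly R (β ∷ α ∷ []) M k j ≡ scalar β k j + α * M k j
    linear k j = cong (scalar β k j +_) (trans (·-congʳ M constant k j) (·-scalar M α k j))

  formal : ∀ {n} → PositiveExpr n → Polynomial n
  formal (atom k) = var k
  formal one      = con 1ℤ
  formal (e ⊕ f)  = formal e :+ formal f
  formal (e ⊗ f)  = formal e :* formal f

  ⟦_⟧₊ : ∀ {n} → PositiveExpr n → Vec ℝ n → ℝ
  ⟦ e ⟧₊ = ⟦ formal e ⟧

  positive : ∀ {n} (e : PositiveExpr n) (ρ : Vec ℝ n) → (∀ k → 0ℝ < lookup ρ k) → 0ℝ < ⟦ e ⟧₊ ρ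
  positive (atom k) ρ ρ>0 = ρ>0 k
  positive one      ρ ρ>0 = 0<1
  positive (e ⊕ f)  ρ ρ>0 = +-pos (positive e ρ ρ>0) (positive f ρ ρ>0)
  positive (e ⊗ f)  ρ ρ>0 = *-pos (positive e ρ ρ>0) (positive f ρ ρ>0)

  x₀ x₁ x₂ y₀ y₁ y₂ : PositiveExpr 6
  x₀ = atom 0F
  x₁ = atom 1F
  x₂ = atom 2F
  y₀ = atom 3F
  y₁ = atom 4F
  y₂ = atom 5F

  cyclicE : Fin 3 → Fin 3 → Polynomial 6
  cyclicE 0F 0F = con 0ℤ
  cyclicE 0F 1F = :- formal x₀
  cyclicE 0F 2F = formal y₀
  cyclicE 1F 0F = formal y₁
  cyclicE 1F 1F = con 0ℤ
  cyclicE 1F 2F = :- formal x₁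
  cyclicE 2F 0F = :- formal x₂
  cyclicE 2F 1F = formal y₂
  cyclicE 2F 2F = con 0ℤ

  -- The weights tᵢ of the 2-cycles i → i+1 → i, and the coefficients of p.
  t₀ t₁ t₂ s α β γ : PositiveExpr 6
  t₀ = x₀ ⊗ y₁
  t₁ = x₁ ⊗ y₂
  t₂ = x₂ ⊗ y₀
  s  = t₀ ⊕ t₁ ⊕ t₂
  α  = s ⊕ one
  β  = y₀ ⊗ y₁ ⊗ y₂
  γ  = α ⊗ s ⊕ one

  target : Fin 3 → Fin 3 → PositiveExpr 6
  target 0F 0F = one ⊕ α ⊗ t₁
  target 0F 1F = y₀ ⊗ y₂ ⊗ (one ⊕ t₁ ⊕ t₂)
  target 0F 2F = β ⊗ y₀ ⊕ α ⊗ x₀ ⊗ x₁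
  target 1F 0F = β ⊗ y₁ ⊕ α ⊗ x₁ ⊗ x₂
  target 1F 1F = one ⊕ α ⊗ t₂
  target 1F 2F = y₁ ⊗ y₀ ⊗ (one ⊕ t₂ ⊕ t₀)
  target 2F 0F = y₂ ⊗ y₁ ⊗ (one ⊕ t₀ ⊕ t₁)
  target 2F 1F = β ⊗ y₂ ⊕ α ⊗ x₂ ⊗ x₀
  target 2F 2F = one ⊕ α ⊗ t₀

  -- Formal counterparts of the identity matrix and of γI + βX + αX²; the sum
  -- in squareE is the one computed by the matrix product of Defs, so that
  -- quadraticE evaluates definitionally to the right-hand side of
  -- evalPoly-quadratic at the cyclic matrix (up to the identity entry).
  identityE : ∀ {n m} → Fin n → Fin n → Polynomial m
  identityE zero    zero    = con 1ℤ
  identityE zero    (suc j) = con 0ℤ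
  identityE (suc i) zero    = con 0ℤ
  identityE (suc i) (suc j) = identityE i j

  quadraticE : Fin 3 → Fin 3 → Polynomial 6
  quadraticE i j = formal γ :* identityE i j :+ (formal β :* cyclicE i j :+ formal α :* squareE)
    where
    squareE : Polynomial 6
    squareE = cyclicE i 0F :* cyclicE 0F j
           :+ (cyclicE i 1F :* cyclicE 1F j :+ (cyclicE i 2F :* cyclicE 2F j :+ con 0ℤ))

  normal-forms : ∀ i j ρ → ⟦ quadraticE i j ⟧↓ ρ ≡ ⟦ formal (target i j) ⟧↓ ρ
  normal-forms 0F 0F ρ = refl
  normal-forms 0F 1F ρ = refl
  normal-forms 0F 2F ρ = refl
  normal-forms 1F 0F ρ = refl
  normal-forms 1F 1F ρ = refl
  normal-forms 1F 2F ρ = refl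
  normal-forms 2F 0F ρ = refl
  normal-forms 2F 1F ρ = refl
  normal-forms 2F 2F ρ = refl

  cyclic : Vec ℝ 6 → Matrix R 3
  cyclic ρ i j = ⟦ cyclicE i j ⟧ ρ

  coefficients : Vec ℝ 6 → List ℝ
  coefficients ρ = ⟦ γ ⟧₊ ρ ∷ ⟦ β ⟧₊ ρ ∷ ⟦ α ⟧₊ ρ ∷ []

  identity-formal : ∀ {n m} (ρ : Vec ℝ m) (i j : Fin n) → identity R i j ≡ ⟦ identityE i j ⟧ ρ
  identity-formal ρ zero    zero    = refl
  identity-formal ρ zero    (suc j) = refl
  identity-formal ρ (suc i) zero    = refl
  identity-formal ρ (suc i) (suc j) = identity-formal ρ i j

  cyclic-entry : ∀ ρ i j → evalPoly R (coefficients ρ) (cyclic ρ) i j ≡ ⟦ target i j ⟧₊ ρ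
  cyclic-entry ρ i j = begin
    evalPoly R (coefficients ρ) (cyclic ρ) i j
      ≡⟨ evalPoly-quadratic _ _ _ (cyclic ρ) i j ⟩
    ⟦ γ ⟧₊ ρ * identity R i j + (⟦ β ⟧₊ ρ * cyclic ρ i j + ⟦ α ⟧₊ ρ * (cyclic ρ · cyclic ρ) i j)
      ≡⟨ cong₂ _+_ (cong (⟦ γ ⟧₊ ρ *_) (identity-formal ρ i j)) refl ⟩
    ⟦ quadraticE i j ⟧ ρ
      ≡⟨ prove ρ (quadraticE i j) (formal (target i j)) (normal-forms i j ρ) ⟩
    ⟦ target i j ⟧₊ ρ ∎

  cyclic-algebraicallyPositive : ∀ ρ → (∀ k → 0ℝ < lookup ρ k) →
                                 ∀ i j → 0ℝ < evalPoly R (coefficients ρ) (cyclic ρ) i j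
  cyclic-algebraicallyPositive ρ ρ>0 i j =
    subst (0ℝ <_) (sym (cyclic-entry ρ i j)) (positive (target i j) ρ ρ>0)

  parameters : Matrix R 3 → Vec ℝ 6
  parameters X = - X 0F 1F ∷ - X 1F 2F ∷ - X 2F 0F ∷ X 0F 2F ∷ X 1F 0F ∷ X 2F 1F ∷ []

  parameters-positive : ∀ X → InQ R S₃ X → ∀ k → 0ℝ < lookup (parameters X) k
  parameters-positive X X∈Q 0F = neg-pos (X∈Q 0F 1F)
  parameters-positive X X∈Q 1F = neg-pos (X∈Q 1F 2F)
  parameters-positive X X∈Q 2F = neg-pos (X∈Q 2F 0F)
  parameters-positive X X∈Q 3F = X∈Q 0F 2F
  parameters-positive X X∈Q 4F = X∈Q 1F 0F
  parameters-positive X X∈Q 5F = X∈Q 2F 1F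

  cyclic-parameters : ∀ X → InQ R S₃ X → ∀ i j → X i j ≡ cyclic (parameters X) i j
  cyclic-parameters X X∈Q 0F 0F = X∈Q 0F 0F
  cyclic-parameters X X∈Q 0F 1F = sym (-‿involutive _)
  cyclic-parameters X X∈Q 0F 2F = refl
  cyclic-parameters X X∈Q 1F 0F = refl
  cyclic-parameters X X∈Q 1F 1F = X∈Q 1F 1F
  cyclic-parameters X X∈Q 1F 2F = sym (-‿involutive _)
  cyclic-parameters X X∈Q 2F 0F = sym (-‿involutive _)
  cyclic-parameters X X∈Q 2F 1F = refl
  cyclic-parameters X X∈Q 2F 2F = X∈Q 2F 2F

mainTheorem14 : (R : RealNumbers) → RequiresAlgebraicPositivity R S₃
mainTheorem14 R X X∈Q = coefficients ρ , λ i j →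
  ≡.subst (0ℝ <_) (≡.sym (evalPoly-cong (coefficients ρ) (cyclic-parameters X X∈Q) i j))
        (cyclic-algebraicallyPositive ρ (parameters-positive X X∈Q) i j)
  where
  open RealNumbers R using (ℝ; 0ℝ; _<_)
  open Theory R
  ρ : Vec ℝ 6
  ρ = parameters X
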